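{- For every $\Delta^0_2$ function $f : \omega\to\omega$, there is a $\Delta^0_2$ increasing function $g : \omega\to\omega$ such that $f$ does not dominate $p_H$ for any infinite $g$-transitive set $H$.
   Context: Given $g$, an interval $[a,b]$ is $g$-large if $b \geq g(a)$ and $g$-small otherwise; a set $H$ is $g$-transitive if for every $x<y<z$ in $H$ with $[x,y]$ and $[y,z]$ $g$-small, $[x,z]$ is $g$-small. The principal function of an infinite set $H = \{x_0<x_1<\dots\}$ is $p_H(n) = x_n$. $f$ dominates $p_H$ if $f(x) \geq p_H(x)$ for every $x$. -}

module Defs where

open import Data.Nat using (ℕ; zero; suc; _<_; _≤_)
open import Data.Fin using (Fin)
open import Data.Vec using (Vec; []; _∷_; lookup)
open import Data.Product using (Σ; ∃; _×_; _,_)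
open import Relation.Binary.PropositionalEquality using (_≡_)
open import Function.Bundles using (_⇔_)

data Code : ℕ → Set where
  zer  : ∀ {k} → Code k
  succ : Code 1
  proj : ∀ {k} → Fin k → Code k
  comp : ∀ {k m} → Code m → (Fin m → Code k) → Code k
  prec : ∀ {k} → Code k → Code (suc (suc k)) → Code (suc k)
  mu   : ∀ {k} → Code (suc k) → Code k

data Eval : ∀ {k} → Code k → Vec ℕ k → ℕ → Set where
  e-zer  : ∀ {k} {v : Vec ℕ k} → Eval zer v 0
  e-succ : ∀ {n} → Eval succ (n ∷ []) (suc n)
  e-proj : ∀ {k} {i : Fin k} {v : Vec ℕ k} → Eval (proj i) v (lookup v i)
  e-comp : ∀ {k m} {f : Code m} {gs : Fin m → Code k} {v : Vec ℕ k}
             (ys : Vec ℕ m) {y : ℕ} →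
             (∀ i → Eval (gs i) v (lookup ys i)) →
             Eval f ys y → Eval (comp f gs) v y
  e-prec0 : ∀ {k} {f : Code k} {g : Code (suc (suc k))} {v : Vec ℕ k} {y : ℕ} →
             Eval f v y → Eval (prec f g) (0 ∷ v) y
  e-precS : ∀ {k} {f : Code k} {g : Code (suc (suc k))} {v : Vec ℕ k} {n z y : ℕ} →
             Eval (prec f g) (n ∷ v) z → Eval g (n ∷ z ∷ v) y →
             Eval (prec f g) (suc n ∷ v) y
  e-mu   : ∀ {k} {f : Code (suc k)} {v : Vec ℕ k} {n : ℕ} →
             Eval f (n ∷ v) 0 →
             (∀ m → m < n → ∃ λ z → Eval f (m ∷ v) (suc z)) →
             Eval (mu f) v n

Total : ∀ {k} → Code k → Set
Total {k} c = (v : Vec ℕ k) → ∃ λ y → Eval c v y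

-- Arithmetic hierarchy, level 2, for relations on ℕ^k.
-- The matrix is a computable relation, given by a total code c,
-- the relation holding iff c outputs 0.

Σ⁰₂ : ∀ {k} → (Vec ℕ k → Set) → Set
Σ⁰₂ {k} P = Σ (Code (suc (suc k))) λ c → Total c ×
  ((v : Vec ℕ k) → P v ⇔ (∃ λ a → (b : ℕ) → Eval c (a ∷ b ∷ v) 0))

Π⁰₂ : ∀ {k} → (Vec ℕ k → Set) → Set
Π⁰₂ {k} P = Σ (Code (suc (suc k))) λ c → Total c ×
  ((v : Vec ℕ k) → P v ⇔ ((a : ℕ) → ∃ λ b → Eval c (a ∷ b ∷ v) 0))

Δ⁰₂ : ∀ {k} → (Vec ℕ k → Set) → Set
Δ⁰₂ P = Σ⁰₂ P × Π⁰₂ P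

Graph : (ℕ → ℕ) → Vec ℕ 2 → Set
Graph f (x ∷ y ∷ []) = f x ≡ y

Δ⁰₂-function : (ℕ → ℕ) → Set
Δ⁰₂-function f = Δ⁰₂ (Graph f)

StrictlyIncreasing : (ℕ → ℕ) → Set
StrictlyIncreasing h = ∀ {x y} → x < y → h x < h y

g-large : (ℕ → ℕ) → ℕ → ℕ → Set
g-large g a b = g a ≤ b

g-small : (ℕ → ℕ) → ℕ → ℕ → Set
g-small g a b = b < g a

-- An infinite set H = {x₀ < x₁ < ...} is represented by its principal
-- function p_H = h (a strictly increasing h : ℕ → ℕ, H = range h).
g-transitive : (g h : ℕ → ℕ) → Set
g-transitive g h = ∀ i j k → i < j → j < k →
  g-small g (h i) (h j) → g-small g (h j) (h k) → g-small g (h i) (h k)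

Dominates : (f p : ℕ → ℕ) → Set
Dominates f p = ∀ x → p x ≤ f x

-- Take g a to be the code of the history f 0, …, f (1 + a). It is strictly
-- increasing and exceeds f (1 + a), so if f dominated the principal function h
-- of a g-transitive set, then h (1 + i) ≤ f (1 + i) < g i ≤ g (h i) makes every
-- [h i, h (1 + i)] g-small; by transitivity every [h 0, h j] is g-small, i.e.
-- h is bounded by g (h 0), which is absurd.
-- The graph of g is Δ⁰₂ because for Δ⁰₂ R the relation "y codes a sequence
-- whose j-th entry e satisfies R (j , e)" is again Δ⁰₂: the finitely many
-- witnesses, one per entry, are packed into a single sequence code.

module Submission where

open import Defs
open import Data.Fin using (Fin; #_) renaming (zero to fzero; suc to fsuc)
open import Data.Nat using (ℕ; zero; suc; pred; _+_; _∸_; _<_; _≤_; _≤?_; z≤n; s≤s; z<s)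
open import Data.Nat.Properties
open import Data.Product using (Σ; ∃; _×_; _,_; proj₁; proj₂)
open import Data.Sum using (inj₁; inj₂)
open import Data.Vec using (Vec; []; _∷_; lookup; tabulate)
open import Data.Vec.Properties using (lookup∘tabulate; tabulate∘lookup; tabulate-cong)
open import Function.Base using (_∘_)
open import Function.Bundles using (_⇔_; mk⇔; Equivalence)
open import Function.Construct.Composition using (_⇔-∘_)
open import Function.Construct.Symmetry using (⇔-sym)
open import Relation.Binary.Core using (_Preserves_⟶_)
open import Relation.Binary.Definitions using (tri<; tri≈; tri>)
open import Relation.Binary.PropositionalEquality
open import Relation.Nullary using (¬_; yes; no; contradiction)

open Equivalence using (to; from)

Eval-functional : ∀ {k} {c : Code k} {v : Vec ℕ k} {y y′} →
                  Eval c v y → Eval c v y′ → y ≡ y′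
Eval-functional e-zer e-zer = refl
Eval-functional e-succ e-succ = refl
Eval-functional e-proj e-proj = refl
Eval-functional (e-comp ys es e) (e-comp ys′ es′ e′) =
  Eval-functional e (subst (λ zs → Eval _ zs _) (sym ys≡ys′) e′)
  where
  ys≡ys′ : ys ≡ ys′
  ys≡ys′ = begin
    ys                   ≡⟨ tabulate∘lookup ys ⟨
    tabulate (lookup ys)  ≡⟨ tabulate-cong (λ i → Eval-functional (es i) (es′ i)) ⟩
    tabulate (lookup ys′) ≡⟨ tabulate∘lookup ys′ ⟩
    ys′                  ∎
    where open ≡-Reasoning
Eval-functional (e-prec0 e) (e-prec0 e′) = Eval-functional e e′
Eval-functional (e-precS e₁ e₂) (e-precS e₁′ e₂′) with refl ← Eval-functional e₁ e₁′ =
  Eval-functional e₂ e₂′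
Eval-functional (e-mu {n = n} e₀ below) (e-mu {n = n′} e₀′ below′) with <-cmp n n′
... | tri≈ _ n≡n′ _ = n≡n′
... | tri< n<n′ _ _ with () ← Eval-functional e₀ (proj₂ (below′ n n<n′))
... | tri> _ _ n′<n with () ← Eval-functional (proj₂ (below n′ n′<n)) e₀′

record Program (k : ℕ) : Set where
  field
    code : Code k
    run  : Vec ℕ k → ℕ
    eval : ∀ v → Eval code v (run v)
open Program public

run≡⇔Eval : ∀ {k} (p : Program k) {v y} → run p v ≡ y ⇔ Eval (code p) v y
run≡⇔Eval p {v} = mk⇔ (λ { refl → eval p v }) (Eval-functional (eval p v))

total : ∀ {k} (p : Program k) → Total (code p)
total p v = run p v , eval p v

programOf : ∀ {k} (c : Code k) → Total c → Program k
programOf c c-total = record { code = c ; run = proj₁ ∘ c-total ; eval = proj₂ ∘ c-total }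

withRun : ∀ {k} (F : Vec ℕ k → ℕ) (p : Program k) → (∀ v → run p v ≡ F v) → Program k
withRun F p run≡F = record
  { code = code p ; run = F ; eval = λ v → subst (Eval (code p) v) (run≡F v) (eval p v) }

zeroᵖ : ∀ {k} → Program k
zeroᵖ = record { code = zer ; run = λ _ → 0 ; eval = λ _ → e-zer }

sucᵖ : Program 1
sucᵖ = record { code = succ ; run = λ { (n ∷ []) → suc n } ; eval = λ { (n ∷ []) → e-succ } }

π : ∀ {k} → Fin k → Program k
π i = record { code = proj i ; run = λ v → lookup v i ; eval = λ _ → e-proj }

compᵖ : ∀ {k m} → Program m → (Fin m → Program k) → Program k
compᵖ f gs = record
  { code = comp (code f) (code ∘ gs)
  ; run  = λ v → run f (tabulate λ i → run (gs i) v)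
  ; eval = λ v → e-comp _ (λ i → subst (Eval (code (gs i)) v) (sym (lookup∘tabulate _ i)) (eval (gs i) v))
                        (eval f _)
  }

infixr 9 _∘ᵖ_
_∘ᵖ_ : ∀ {k m} → Program m → Vec (Program k) m → Program k
f ∘ᵖ gs = compᵖ f (lookup gs)

primrec : ∀ {k} → (Vec ℕ k → ℕ) → (Vec ℕ (2 + k) → ℕ) → Vec ℕ (suc k) → ℕ
primrec F G (zero  ∷ v) = F v
primrec F G (suc n ∷ v) = G (n ∷ primrec F G (n ∷ v) ∷ v)

recᵖ : ∀ {k} → Program k → Program (2 + k) → Program (suc k)
recᵖ f g = record { code = prec (code f) (code g) ; run = primrec (run f) (run g) ; eval = eval-rec }
  where
  eval-rec : ∀ v → Eval (prec (code f) (code g)) v (primrec (run f) (run g) v)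
  eval-rec (zero  ∷ v) = e-prec0 (eval f v)
  eval-rec (suc n ∷ v) = e-precS (eval-rec (n ∷ v)) (eval g _)

oneᵖ : ∀ {k} → Program k
oneᵖ = sucᵖ ∘ᵖ (zeroᵖ ∷ [])

predᵖ : Program 1
predᵖ = withRun (λ { (n ∷ []) → pred n }) (recᵖ zeroᵖ (π (# 0)))
  λ { (zero ∷ []) → refl ; (suc n ∷ []) → refl }

∸ᵖ : Program 2
∸ᵖ = withRun (λ { (x ∷ n ∷ []) → x ∸ n }) (monus ∘ᵖ (π (# 1) ∷ π (# 0) ∷ []))
  λ { (x ∷ n ∷ []) → run-monus x n }
  where
  monus : Program 2
  monus = recᵖ (π (# 0)) (predᵖ ∘ᵖ (π (# 1) ∷ []))
  run-monus : ∀ x n → run monus (n ∷ x ∷ []) ≡ x ∸ n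
  run-monus x zero    = refl
  run-monus x (suc n) = trans (cong pred (run-monus x n)) (pred[m∸n]≡m∸[1+n] x n)

+ᵖ : Program 2
+ᵖ = withRun (λ { (x ∷ y ∷ []) → x + y }) plus λ { (x ∷ y ∷ []) → run-plus x y }
  where
  plus : Program 2
  plus = recᵖ (π (# 0)) (sucᵖ ∘ᵖ (π (# 1) ∷ []))
  run-plus : ∀ x y → run plus (x ∷ y ∷ []) ≡ x + y
  run-plus zero    y = refl
  run-plus (suc x) y = cong suc (run-plus x y)

-- Cantor pairing

tri : ℕ → ℕ
tri zero    = 0
tri (suc n) = tri n + suc n

-- diag z is the d with tri d ≤ z < tri (1 + d): the step adds 1 exactly when
-- tri (1 + diag z) ≤ 1 + z, written with ∸ so that it is primitive recursive.
diag : ℕ → ℕ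
diag zero    = 0
diag (suc z) = diag z + (1 ∸ (tri (suc (diag z)) ∸ suc z))

⟨_,_⟩ : ℕ → ℕ → ℕ
⟨ p , x ⟩ = tri (p + x) + x

unpair₂ : ℕ → ℕ
unpair₂ z = z ∸ tri (diag z)

unpair₁ : ℕ → ℕ
unpair₁ z = diag z ∸ unpair₂ z

tri-mono-≤ : tri Preserves _≤_ ⟶ _≤_
tri-mono-≤ {_}     {zero}  z≤n       = ≤-refl
tri-mono-≤ {zero}  {suc n} _         = z≤n
tri-mono-≤ {suc m} {suc n} (s≤s m≤n) = +-mono-≤ (tri-mono-≤ m≤n) (s≤s m≤n)

diag-bounds : ∀ z → tri (diag z) ≤ z × z < tri (suc (diag z))
diag-bounds zero = z≤n , s≤s z≤n
diag-bounds (suc z) with diag-bounds z | tri (suc (diag z)) ≤? suc z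
... | _ , z<t | yes t≤1+z
  rewrite m≤n⇒m∸n≡0 t≤1+z | +-comm (diag z) 1 | ≤-antisym t≤1+z z<t =
  ≤-refl , m<m+n (suc z) z<s
... | t≤z , _ | no t≰1+z
  rewrite m≤n⇒m∸n≡0 (m<n⇒0<n∸m (≰⇒> t≰1+z)) | +-identityʳ (diag z) =
  m≤n⇒m≤1+n t≤z , ≰⇒> t≰1+z

diag-unique : ∀ {d z} → tri d ≤ z → z < tri (suc d) → diag z ≡ d
diag-unique {d} {z} t≤z z<t with <-cmp (diag z) d | diag-bounds z
... | tri≈ _ diag≡d _ | _ = diag≡d
... | tri< diag<d _ _ | _ , z<t′ = contradiction (≤-trans (tri-mono-≤ diag<d) t≤z) (<⇒≱ z<t′)
... | tri> _ _ d<diag | t≤z′ , _ = contradiction (≤-trans (tri-mono-≤ d<diag) t≤z′) (<⇒≱ z<t)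

diag-⟨,⟩ : ∀ p x → diag ⟨ p , x ⟩ ≡ p + x
diag-⟨,⟩ p x = diag-unique (m≤m+n _ x) (+-monoʳ-< (tri (p + x)) (s≤s (m≤n+m x p)))

unpair₂-⟨,⟩ : ∀ p x → unpair₂ ⟨ p , x ⟩ ≡ x
unpair₂-⟨,⟩ p x rewrite diag-⟨,⟩ p x = m+n∸m≡n (tri (p + x)) x

unpair₁-⟨,⟩ : ∀ p x → unpair₁ ⟨ p , x ⟩ ≡ p
unpair₁-⟨,⟩ p x = trans (cong₂ _∸_ (diag-⟨,⟩ p x) (unpair₂-⟨,⟩ p x)) (m+n∸n≡m p x)

unpair₂≤diag : ∀ z → unpair₂ z ≤ diag z
unpair₂≤diag z = +-cancelˡ-≤ (tri (diag z)) _ _ (≤-pred (begin-strict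
  tri (diag z) + unpair₂ z    ≡⟨ m+[n∸m]≡n (proj₁ (diag-bounds z)) ⟩
  z                           <⟨ proj₂ (diag-bounds z) ⟩
  tri (diag z) + suc (diag z) ≡⟨ +-suc (tri (diag z)) (diag z) ⟩
  suc (tri (diag z) + diag z) ∎))
  where open ≤-Reasoning

⟨unpair₁,unpair₂⟩ : ∀ z → ⟨ unpair₁ z , unpair₂ z ⟩ ≡ z
⟨unpair₁,unpair₂⟩ z = begin
  tri (unpair₁ z + unpair₂ z) + unpair₂ z ≡⟨ cong (λ d → tri d + unpair₂ z) (m∸n+n≡m (unpair₂≤diag z)) ⟩
  tri (diag z) + unpair₂ z               ≡⟨ m+[n∸m]≡n (proj₁ (diag-bounds z)) ⟩
  z                                      ∎
  where open ≡-Reasoning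

m≤⟨m,n⟩ : ∀ m n → m ≤ ⟨ m , n ⟩
m≤⟨m,n⟩ m n = ≤-trans (m≤m+n m n) (≤-trans (n≤tri (m + n)) (m≤m+n _ n))
  where
  n≤tri : ∀ n → n ≤ tri n
  n≤tri zero    = z≤n
  n≤tri (suc n) = m≤n+m (suc n) (tri n)

n≤⟨m,n⟩ : ∀ m n → n ≤ ⟨ m , n ⟩
n≤⟨m,n⟩ m n = m≤n+m n _

-- Codes of finite sequences

history : (ℕ → ℕ) → ℕ → ℕ
history s zero    = 0
history s (suc n) = suc ⟨ history s n , s n ⟩

init : ℕ → ℕ
init y = unpair₁ (pred y)

last : ℕ → ℕ
last y = unpair₂ (pred y)

initⁿ : ℕ → ℕ → ℕ
initⁿ zero    y = y
initⁿ (suc k) y = init (initⁿ k y)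

entry : ℕ → ℕ → ℕ
entry k y = last (initⁿ k y)

HasLength : ℕ → ℕ → Set
HasLength zero    y = y ≡ 0
HasLength (suc m) y = initⁿ m y ≢ 0 × initⁿ (suc m) y ≡ 0

initⁿ-init : ∀ k y → initⁿ k (init y) ≡ initⁿ (suc k) y
initⁿ-init zero    y = refl
initⁿ-init (suc k) y = cong init (initⁿ-init k y)

initⁿ-zero : ∀ k → initⁿ k 0 ≡ 0
initⁿ-zero zero    = refl
initⁿ-zero (suc k) = cong init (initⁿ-zero k)

suc⟨init,last⟩ : ∀ {y} → y ≢ 0 → suc ⟨ init y , last y ⟩ ≡ y
suc⟨init,last⟩ {zero}  y≢0 = contradiction refl y≢0
suc⟨init,last⟩ {suc y} _   = cong suc (⟨unpair₁,unpair₂⟩ y)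

init-history : ∀ s n → init (history s n) ≡ history s (pred n)
init-history s zero    = refl
init-history s (suc n) = unpair₁-⟨,⟩ (history s n) (s n)

initⁿ-history : ∀ s n k → initⁿ k (history s n) ≡ history s (n ∸ k)
initⁿ-history s n zero    = refl
initⁿ-history s n (suc k) = begin
  init (initⁿ k (history s n)) ≡⟨ cong init (initⁿ-history s n k) ⟩
  init (history s (n ∸ k))     ≡⟨ init-history s (n ∸ k) ⟩
  history s (pred (n ∸ k))     ≡⟨ cong (history s) (pred[m∸n]≡m∸[1+n] n k) ⟩
  history s (n ∸ suc k)        ∎
  where open ≡-Reasoning

entry-history : ∀ s {m k} → k ≤ m → entry k (history s (suc m)) ≡ s (m ∸ k)
entry-history s {m} {k} k≤m rewrite initⁿ-history s (suc m) k | +-∸-assoc 1 k≤m =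
  unpair₂-⟨,⟩ (history s (m ∸ k)) (s (m ∸ k))

history-HasLength : ∀ s n → HasLength n (history s n)
history-HasLength s zero = refl
history-HasLength s (suc m) =
  subst (_≢ 0) (sym (trans (initⁿ-history s (suc m) m) (cong (history s) (m+n∸n≡m 1 m)))) (λ ()) ,
  trans (initⁿ-history s (suc m) (suc m)) (cong (history s) (n∸n≡0 m))

history-unique : ∀ s m y → HasLength (suc m) y →
                 (∀ k → k ≤ m → s (m ∸ k) ≡ entry k y) → y ≡ history s (suc m)
init-history-unique : ∀ s m y → HasLength (suc m) y →
                      (∀ k → k ≤ m → s (m ∸ k) ≡ entry k y) → init y ≡ history s m

history-unique s m y len@(initᵐ≢0 , _) entries = begin
  y                       ≡⟨ suc⟨init,last⟩ y≢0 ⟨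
  suc ⟨ init y , last y ⟩ ≡⟨ cong₂ (λ p x → suc ⟨ p , x ⟩)
                                    (init-history-unique s m y len entries) (sym (entries 0 z≤n)) ⟩
  history s (suc m)       ∎
  where
  open ≡-Reasoning
  y≢0 : y ≢ 0
  y≢0 refl = initᵐ≢0 (initⁿ-zero m)

init-history-unique s zero    y (_ , init≡0) _ = init≡0
init-history-unique s (suc m) y (initᵐ⁺¹≢0 , initᵐ⁺²≡0) entries =
  history-unique s m (init y)
    (initᵐ⁺¹≢0 ∘ trans (sym (initⁿ-init m y)) , trans (initⁿ-init (suc m) y) initᵐ⁺²≡0)
    (λ k k≤m → trans (entries (suc k) (s≤s k≤m)) (cong last (sym (initⁿ-init k y))))

collect : (n : ℕ) → ((k : ℕ) → k ≤ n → ℕ) → ℕ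
collect n W = history (λ j → W (n ∸ j) (m∸n≤m n j)) (suc n)

entry-collect : ∀ n W {k} (k≤n : k ≤ n) → entry k (collect n W) ≡ W k k≤n
entry-collect n W {k} k≤n = trans (entry-history _ k≤n) (W-cong (m∸[m∸n]≡n k≤n))
  where
  W-cong : ∀ {j j≤n} → j ≡ k → W j j≤n ≡ W k k≤n
  W-cong refl = cong (W k) (≤-irrelevant _ _)

history<history-suc : ∀ s n → history s n < history s (suc n)
history<history-suc s n = s≤s (m≤⟨m,n⟩ (history s n) (s n))

history-strictlyIncreasing : ∀ s → StrictlyIncreasing (history s)
history-strictlyIncreasing s {x} {suc y} (s≤s x≤y) with m≤n⇒m<n∨m≡n x≤y
... | inj₁ x<y  = <-trans (history-strictlyIncreasing s x<y) (history<history-suc s y)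
... | inj₂ refl = history<history-suc s y

s<history : ∀ s n → s n < history s (suc n)
s<history s n = s≤s (n≤⟨m,n⟩ (history s n) (s n))

triᵖ : Program 1
triᵖ = withRun (λ { (n ∷ []) → tri n }) tri-rec λ { (n ∷ []) → run-tri n }
  where
  tri-rec : Program 1
  tri-rec = recᵖ zeroᵖ (+ᵖ ∘ᵖ (π (# 1) ∷ sucᵖ ∘ᵖ (π (# 0) ∷ []) ∷ []))
  run-tri : ∀ n → run tri-rec (n ∷ []) ≡ tri n
  run-tri zero    = refl
  run-tri (suc n) = cong (_+ suc n) (run-tri n)

diagᵖ : Program 1
diagᵖ = withRun (λ { (n ∷ []) → diag n }) diag-rec λ { (n ∷ []) → run-diag n }
  where
  diag-rec : Program 1
  diag-rec = recᵖ zeroᵖ (+ᵖ ∘ᵖ (π (# 1) ∷ ∸ᵖ ∘ᵖ (oneᵖ ∷ ∸ᵖ ∘ᵖ (triᵖ ∘ᵖ (sucᵖ ∘ᵖ (π (# 1) ∷ []) ∷ [])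
                                                  ∷ sucᵖ ∘ᵖ (π (# 0) ∷ []) ∷ []) ∷ []) ∷ []))
  run-diag : ∀ n → run diag-rec (n ∷ []) ≡ diag n
  run-diag zero    = refl
  run-diag (suc n) = cong (λ d → d + (1 ∸ (tri (suc d) ∸ suc n))) (run-diag n)

unpair₂ᵖ : Program 1
unpair₂ᵖ = ∸ᵖ ∘ᵖ (π (# 0) ∷ triᵖ ∘ᵖ (diagᵖ ∷ []) ∷ [])

unpair₁ᵖ : Program 1
unpair₁ᵖ = ∸ᵖ ∘ᵖ (diagᵖ ∷ unpair₂ᵖ ∷ [])

initᵖ : Program 1
initᵖ = unpair₁ᵖ ∘ᵖ (predᵖ ∷ [])

lastᵖ : Program 1
lastᵖ = unpair₂ᵖ ∘ᵖ (predᵖ ∷ [])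

initⁿᵖ : Program 2
initⁿᵖ = withRun (λ { (k ∷ y ∷ []) → initⁿ k y }) initⁿ-rec λ { (k ∷ y ∷ []) → run-initⁿ k y }
  where
  initⁿ-rec : Program 2
  initⁿ-rec = recᵖ (π (# 0)) (initᵖ ∘ᵖ (π (# 1) ∷ []))
  run-initⁿ : ∀ k y → run initⁿ-rec (k ∷ y ∷ []) ≡ initⁿ k y
  run-initⁿ zero    y = refl
  run-initⁿ (suc k) y = cong init (run-initⁿ k y)

entryᵖ : Program 2
entryᵖ = lastᵖ ∘ᵖ (initⁿᵖ ∷ [])

hasLengthᵖ : Program 2
hasLengthᵖ = +ᵖ ∘ᵖ (∸ᵖ ∘ᵖ (oneᵖ ∷ initⁿᵖ ∷ []) ∷ initⁿᵖ ∘ᵖ (sucᵖ ∘ᵖ (π (# 0) ∷ []) ∷ π (# 1) ∷ []) ∷ [])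

run-hasLengthᵖ≡0⇔ : ∀ m y → run hasLengthᵖ (m ∷ y ∷ []) ≡ 0 ⇔ HasLength (suc m) y
run-hasLengthᵖ≡0⇔ m y = mk⇔
  (λ sum≡0 → (λ initᵐ≡0 → contradiction (trans (cong (1 ∸_) (sym initᵐ≡0)) (m+n≡0⇒m≡0 _ sum≡0)) λ ())
           , m+n≡0⇒n≡0 _ sum≡0)
  (λ (initᵐ≢0 , initᵐ⁺¹≡0) → cong₂ _+_ (m≤n⇒m∸n≡0 (n≢0⇒n>0 initᵐ≢0)) initᵐ⁺¹≡0)

sum≤ : (ℕ → ℕ) → ℕ → ℕ
sum≤ F zero    = F 0
sum≤ F (suc n) = sum≤ F n + F (suc n)

sum≤≡0⇔ : ∀ F n → sum≤ F n ≡ 0 ⇔ (∀ i → i ≤ n → F i ≡ 0)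
sum≤≡0⇔ F n = mk⇔ (sum≡0⇒ n) (⇒sum≡0 n)
  where
  sum≡0⇒ : ∀ n → sum≤ F n ≡ 0 → ∀ i → i ≤ n → F i ≡ 0
  sum≡0⇒ zero    sum≡0 .zero z≤n = sum≡0
  sum≡0⇒ (suc n) sum≡0 i i≤1+n with m≤n⇒m<n∨m≡n i≤1+n
  ... | inj₁ i<1+n = sum≡0⇒ n (m+n≡0⇒m≡0 _ sum≡0) i (≤-pred i<1+n)
  ... | inj₂ refl  = m+n≡0⇒n≡0 (sum≤ F n) sum≡0
  ⇒sum≡0 : ∀ n → (∀ i → i ≤ n → F i ≡ 0) → sum≤ F n ≡ 0
  ⇒sum≡0 zero    F≡0 = F≡0 0 z≤n
  ⇒sum≡0 (suc n) F≡0 = cong₂ _+_ (⇒sum≡0 n (λ i i≤n → F≡0 i (m≤n⇒m≤1+n i≤n))) (F≡0 (suc n) ≤-refl)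

sumᵖ : ∀ {k} → Program (suc k) → Program (suc k)
sumᵖ {k} t = withRun (λ { (n ∷ v) → sum≤ (λ i → run t (i ∷ v)) n }) sum-rec λ { (n ∷ v) → run-sum n v }
  where
  sum-rec : Program (suc k)
  sum-rec = recᵖ (compᵖ t λ { fzero → zeroᵖ ; (fsuc i) → π i })
                 (+ᵖ ∘ᵖ (π (# 1) ∷ compᵖ t (λ { fzero → sucᵖ ∘ᵖ (π (# 0) ∷ []) ; (fsuc i) → π (fsuc (fsuc i)) }) ∷ []))
  run-sum : ∀ n v → run sum-rec (n ∷ v) ≡ sum≤ (λ i → run t (i ∷ v)) n
  run-sum zero    v = cong (λ w → run t (0 ∷ w)) (tabulate∘lookup v)
  run-sum (suc n) v = cong₂ _+_ (run-sum n v) (cong (λ w → run t (suc n ∷ w)) (tabulate∘lookup v))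

-- Histories of Δ⁰₂ relations

-- y codes e₀, …, e₁₊ₐ with R (j , eⱼ) for every j (note that entry k y is e₁₊ₐ₋ₖ).
HistoryOf : (Vec ℕ 2 → Set) → Vec ℕ 2 → Set
HistoryOf R (a ∷ y ∷ []) = HasLength (2 + a) y × (∀ k → k ≤ suc a → R (suc a ∸ k ∷ entry k y ∷ []))

boundedᵖ : Program 5 → Program 4
boundedᵖ t = +ᵖ ∘ᵖ (sumᵖ t ∘ᵖ (sucᵖ ∘ᵖ (π (# 2) ∷ []) ∷ π (# 0) ∷ π (# 1) ∷ π (# 2) ∷ π (# 3) ∷ [])
                  ∷ hasLengthᵖ ∘ᵖ (sucᵖ ∘ᵖ (π (# 2) ∷ []) ∷ π (# 3) ∷ []) ∷ [])

Eval-boundedᵖ⇔ : ∀ t {A b a y} → Eval (code (boundedᵖ t)) (A ∷ b ∷ a ∷ y ∷ []) 0 ⇔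
                 ((∀ k → k ≤ suc a → run t (k ∷ A ∷ b ∷ a ∷ y ∷ []) ≡ 0) × HasLength (2 + a) y)
Eval-boundedᵖ⇔ t {A} {b} {a} {y} = mk⇔
  (λ e → to (sum≤≡0⇔ F (suc a)) (m+n≡0⇒m≡0 (sum≤ F (suc a)) (run≡0 e)) ,
         to (run-hasLengthᵖ≡0⇔ (suc a) y) (m+n≡0⇒n≡0 (sum≤ F (suc a)) (run≡0 e)))
  (λ (t≡0 , len) → to (run≡⇔Eval (boundedᵖ t))
     (cong₂ _+_ (from (sum≤≡0⇔ F (suc a)) t≡0) (from (run-hasLengthᵖ≡0⇔ (suc a) y) len)))
  where
  F : ℕ → ℕ
  F k = run t (k ∷ A ∷ b ∷ a ∷ y ∷ [])
  run≡0 : Eval (code (boundedᵖ t)) (A ∷ b ∷ a ∷ y ∷ []) 0 →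
          sum≤ F (suc a) + run hasLengthᵖ (suc a ∷ y ∷ []) ≡ 0
  run≡0 = from (run≡⇔Eval (boundedᵖ t))

positionᵖ : Program 5
positionᵖ = ∸ᵖ ∘ᵖ (sucᵖ ∘ᵖ (π (# 3) ∷ []) ∷ π (# 0) ∷ [])

Σ⁰₂-HistoryOf : ∀ {R} → Σ⁰₂ R → Σ⁰₂ (HistoryOf R)
Σ⁰₂-HistoryOf {R} (c , c-total , R⇔) =
  code M , total M , λ { (a ∷ y ∷ []) → mk⇔ (witness a y) (fromWitness a y) }
  where
  C M : Program 4
  C = programOf c c-total
  M = boundedᵖ (C ∘ᵖ (entryᵖ ∘ᵖ (π (# 0) ∷ π (# 1) ∷ []) ∷ π (# 2) ∷ positionᵖ ∷ entryᵖ ∘ᵖ (π (# 0) ∷ π (# 4) ∷ []) ∷ []))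

  witness : ∀ a y → HistoryOf R (a ∷ y ∷ []) → ∃ λ A → ∀ b → Eval (code M) (A ∷ b ∷ a ∷ y ∷ []) 0
  witness a y (len , r) = collect (suc a) W , λ b → from (Eval-boundedᵖ⇔ _) ((λ k k≤ → C≡0 b k≤) , len)
    where
    W : ∀ k → k ≤ suc a → ℕ
    W k k≤ = proj₁ (to (R⇔ _) (r k k≤))
    C≡0 : ∀ b {k} (k≤ : k ≤ suc a) → run C (entry k (collect (suc a) W) ∷ b ∷ suc a ∸ k ∷ entry k y ∷ []) ≡ 0
    C≡0 b {k} k≤ rewrite entry-collect (suc a) W k≤ = from (run≡⇔Eval C) (proj₂ (to (R⇔ _) (r k k≤)) b)

  fromWitness : ∀ a y → (∃ λ A → ∀ b → Eval (code M) (A ∷ b ∷ a ∷ y ∷ []) 0) → HistoryOf R (a ∷ y ∷ [])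
  fromWitness a y (A , M≡0) =
    proj₂ (to (Eval-boundedᵖ⇔ _) (M≡0 0)) ,
    λ k k≤ → from (R⇔ _) (entry k A , λ b → to (run≡⇔Eval C) (proj₁ (to (Eval-boundedᵖ⇔ _) (M≡0 b)) k k≤))

Π⁰₂-HistoryOf : ∀ {R} → Π⁰₂ R → Π⁰₂ (HistoryOf R)
Π⁰₂-HistoryOf {R} (c , c-total , R⇔) =
  code M , total M , λ { (a ∷ y ∷ []) → mk⇔ (witness a y) (fromWitness a y) }
  where
  C M : Program 4
  C = programOf c c-total
  M = boundedᵖ (C ∘ᵖ (π (# 1) ∷ entryᵖ ∘ᵖ (π (# 0) ∷ π (# 2) ∷ []) ∷ positionᵖ ∷ entryᵖ ∘ᵖ (π (# 0) ∷ π (# 4) ∷ []) ∷ []))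

  witness : ∀ a y → HistoryOf R (a ∷ y ∷ []) → ∀ A → ∃ λ B → Eval (code M) (A ∷ B ∷ a ∷ y ∷ []) 0
  witness a y (len , r) A = collect (suc a) W , from (Eval-boundedᵖ⇔ _) ((λ k k≤ → C≡0 k≤) , len)
    where
    W : ∀ k → k ≤ suc a → ℕ
    W k k≤ = proj₁ (to (R⇔ _) (r k k≤) A)
    C≡0 : ∀ {k} (k≤ : k ≤ suc a) → run C (A ∷ entry k (collect (suc a) W) ∷ suc a ∸ k ∷ entry k y ∷ []) ≡ 0
    C≡0 {k} k≤ rewrite entry-collect (suc a) W k≤ = from (run≡⇔Eval C) (proj₂ (to (R⇔ _) (r k k≤) A))

  fromWitness : ∀ a y → (∀ A → ∃ λ B → Eval (code M) (A ∷ B ∷ a ∷ y ∷ []) 0) → HistoryOf R (a ∷ y ∷ [])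
  fromWitness a y M≡0 =
    proj₂ (to (Eval-boundedᵖ⇔ _) (proj₂ (M≡0 0))) ,
    λ k k≤ → from (R⇔ _) λ A →
      entry k (proj₁ (M≡0 A)) , to (run≡⇔Eval C) (proj₁ (to (Eval-boundedᵖ⇔ _) (proj₂ (M≡0 A))) k k≤)

Δ⁰₂-HistoryOf : ∀ {R} → Δ⁰₂ R → Δ⁰₂ (HistoryOf R)
Δ⁰₂-HistoryOf (ΣR , ΠR) = Σ⁰₂-HistoryOf ΣR , Π⁰₂-HistoryOf ΠR

Δ⁰₂-resp-⇔ : ∀ {k} {P Q : Vec ℕ k → Set} → (∀ v → P v ⇔ Q v) → Δ⁰₂ P → Δ⁰₂ Q
Δ⁰₂-resp-⇔ P⇔Q ((c , c-total , P⇔) , (d , d-total , P⇔′)) =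
  (c , c-total , λ v → P⇔ v ⇔-∘ ⇔-sym (P⇔Q v)) , (d , d-total , λ v → P⇔′ v ⇔-∘ ⇔-sym (P⇔Q v))

HistoryOf-Graph⇔ : ∀ f v → HistoryOf (Graph f) v ⇔ Graph (λ a → history f (2 + a)) v
HistoryOf-Graph⇔ f (a ∷ y ∷ []) = mk⇔
  (λ (len , entries) → sym (history-unique f (suc a) y len entries))
  (λ { refl → history-HasLength f (2 + a) , λ k k≤ → sym (entry-history f k≤) })

Δ⁰₂-history : ∀ f → Δ⁰₂-function f → Δ⁰₂-function (λ a → history f (2 + a))
Δ⁰₂-history f Δf = Δ⁰₂-resp-⇔ (HistoryOf-Graph⇔ f) (Δ⁰₂-HistoryOf Δf)

-- Transitive sets escaping a bound

strictlyIncreasing⇒monotone : ∀ {g} → StrictlyIncreasing g → g Preserves _≤_ ⟶ _≤_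
strictlyIncreasing⇒monotone g-inc x≤y with m≤n⇒m<n∨m≡n x≤y
... | inj₁ x<y  = <⇒≤ (g-inc x<y)
... | inj₂ refl = ≤-refl

strictlyIncreasing⇒inflationary : ∀ {h} → StrictlyIncreasing h → ∀ i → i ≤ h i
strictlyIncreasing⇒inflationary h-inc zero    = z≤n
strictlyIncreasing⇒inflationary h-inc (suc i) = ≤-trans (s≤s (strictlyIncreasing⇒inflationary h-inc i)) (h-inc (n<1+n i))

g-transitive⇒g-small : ∀ {g h} → g-transitive g h → (∀ i → g-small g (h i) (h (suc i))) →
                       ∀ i d → g-small g (h i) (h (suc i + d))
g-transitive⇒g-small {g} h-tr small i zero rewrite +-identityʳ i = small i
g-transitive⇒g-small {g} h-tr small i (suc d) rewrite +-suc i d =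
  h-tr i (suc i + d) (2 + i + d) (s≤s (m≤m+n i d)) (n<1+n _)
       (g-transitive⇒g-small {g} h-tr small i d) (small (suc i + d))

¬Dominates : ∀ {f g h} → g Preserves _≤_ ⟶ _≤_ → (∀ a → f (suc a) < g a) →
             StrictlyIncreasing h → g-transitive g h → ¬ Dominates f h
¬Dominates {f} {g} {h} g-mono f<g h-inc h-tr f≥h = <⇒≱ (g-transitive⇒g-small {g} h-tr small 0 (g (h 0))) (begin
  g (h 0)            ≤⟨ n≤1+n _ ⟩
  suc (g (h 0))      ≤⟨ strictlyIncreasing⇒inflationary h-inc _ ⟩
  h (suc (g (h 0)))  ∎)
  where
  open ≤-Reasoning
  small : ∀ i → h (suc i) < g (h i)
  small i = begin-strict
    h (suc i) ≤⟨ f≥h (suc i) ⟩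
    f (suc i) <⟨ f<g i ⟩
    g i       ≤⟨ g-mono (strictlyIncreasing⇒inflationary h-inc i) ⟩
    g (h i)   ∎

theorem5p16 : (f : ℕ → ℕ) → Δ⁰₂-function f →
    Σ (ℕ → ℕ) λ g → Δ⁰₂-function g × StrictlyIncreasing g ×
      ((h : ℕ → ℕ) → StrictlyIncreasing h → g-transitive g h → ¬ Dominates f h)
theorem5p16 f Δf =
  g , Δ⁰₂-history f Δf , g-inc ,
  λ h h-inc h-tr → ¬Dominates (strictlyIncreasing⇒monotone g-inc) (λ a → s<history f (suc a)) h-inc h-tr
  where
  g : ℕ → ℕ
  g a = history f (2 + a)
  g-inc : StrictlyIncreasing g
  g-inc a<b = history-strictlyIncreasing f (s≤s (s≤s a<b))
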